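{- In a multi-flock chicken graph that has no 2-Duke and has at least three distinct 3-Dukes, there exist at least four distinct 3-Dukes.
   Context: A multi-flock chicken graph is a finite orientation of a complete multipartite graph; vertices are called chickens and partite sets are called flocks. "$c$ pecks $d$" means the edge between $c$ and $d$ is oriented from $c$ to $d$. A peck chain of length $m$ is a directed path with $m$ edges. A chicken $d$ is an $m$-Duke if every chicken not in the flock of $d$ can be reached from $d$ by a peck chain of length at most $m$. -}

module Defs where

open import Data.Nat using (ℕ; zero; suc)
open import Data.Fin using (Fin)
open import Data.Bool using (Bool; true; false)
open import Data.Product using (_×_; Σ; ∃; _,_)
open import Data.Sum using (_⊎_)
open import Relation.Binary.PropositionalEquality using (_≡_; _≢_)
open import Relation.Nullary using (¬_)
open import Function.Definitions using (Injective)

-- It is an orientation of the complete multipartite graph with these parts: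
-- chickens in the same flock are not adjacent (no pecks), and chickens in
-- different flocks are joined by exactly one oriented edge.
record ChickenGraph (n : ℕ) : Set where
  field
    k      : ℕ
    flock  : Fin n → Fin k
    pecks  : Fin n → Fin n → Bool
    same-flock-no-peck : ∀ c d → flock c ≡ flock d → pecks c d ≡ false
    diff-flock-peck    : ∀ c d → flock c ≢ flock d →
                         (pecks c d ≡ true) ⊎ (pecks d c ≡ true)
    antisym            : ∀ c d → pecks c d ≡ true → pecks d c ≡ false

module _ {n : ℕ} (G : ChickenGraph n) where
  open ChickenGraph G

  Pecks : Fin n → Fin n → Set
  Pecks c d = pecks c d ≡ true

  -- PeckChain m c d : there is a peck chain (directed path) of length m from c to d.
  -- (Walks suffice: a shortest walk is a path, so "reachable by a chain of length ≤ m"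
  -- is unaffected.)
  data PeckChain : ℕ → Fin n → Fin n → Set where
    here : ∀ {c} → PeckChain zero c c
    step : ∀ {m c d e} → Pecks c d → PeckChain m d e → PeckChain (suc m) c e

  Reach≤ : ℕ → Fin n → Fin n → Set
  Reach≤ m c d = Σ ℕ λ l → (l Data.Nat.≤ m) × PeckChain l c d

  IsDuke : ℕ → Fin n → Set
  IsDuke m d = ∀ c → flock c ≢ flock d → Reach≤ m d c

  AtLeastDukes : ℕ → ℕ → Set
  AtLeastDukes j m = Σ (Fin j → Fin n) λ f → Injective _≡_ _≡_ f × (∀ i → IsDuke m (f i))

  NoDuke : ℕ → Set
  NoDuke m = ∀ d → ¬ IsDuke m d

-- A non-2-Duke d is outranked by some 3-Duke e, meaning that d does not reach e
-- within two pecks while e pecks someone whom d does not peck.  Starting from a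
-- chicken c unreachable from d, one climbs to a 3-Duke: if t is not a 3-Duke, a
-- chicken z it cannot reach in three pecks pecks every chicken outside z's flock
-- that t reaches in two, so z still outranks d and reaches strictly more chickens
-- than t in two pecks.
-- Outranking is asymmetric and has no 3-cycles; hence, going from one of three
-- given 3-Dukes to the 3-Duke outranking it, one meets a fourth 3-Duke within
-- three steps.
module Submission where

open import Defs
open import Data.Nat using (ℕ; zero; suc; _≤_; z≤n; s≤s)
open import Data.Nat.Properties using (≤-trans)
open import Data.Bool using (true)
import Data.Bool as Bool
open import Data.Fin using (Fin; zero; suc; _≟_)
open import Data.Fin.Properties using (any?; all?; ¬∀⟶∃¬)
open import Data.Fin.Subset using (Subset; _∈_; _⊃_)
open import Data.Fin.Subset.Induction using (⊃-wellFounded)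
open import Data.Vec using (tabulate)
open import Data.Vec.Properties using (lookup∘tabulate; lookup⇒[]=; []=⇒lookup)
open import Data.Vec.Functional using (_∷_)
open import Data.Product using (_×_; Σ; _,_)
open import Data.Sum using (_⊎_; inj₁; inj₂; [_,_]′)
open import Data.Empty using (⊥-elim)
open import Function using (_∘_)
open import Function.Definitions using (Injective)
open import Induction.WellFounded using (Acc; acc)
open import Relation.Nullary using (¬_; Dec; yes; no; does)
open import Relation.Nullary.Decidable using (map′; ¬?; _→-dec_; _×-dec_; _⊎-dec_; dec-true)
open import Relation.Binary.Definitions using (DecidableEquality)
open import Relation.Binary.PropositionalEquality using (_≡_; _≢_; refl; sym; trans; cong)

∷-injective : ∀ {A : Set} {n} {x : A} {f : Fin n → A} →
  Injective _≡_ _≡_ f → (∀ i → f i ≢ x) → Injective _≡_ _≡_ (x ∷ f)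
∷-injective f-inj x∉f {zero}  {zero}  _  = refl
∷-injective f-inj x∉f {zero}  {suc j} eq = ⊥-elim (x∉f j (sym eq))
∷-injective f-inj x∉f {suc i} {zero}  eq = ⊥-elim (x∉f i eq)
∷-injective f-inj x∉f {suc i} {suc j} eq = cong suc (f-inj eq)

module _ {n} {P : Fin n → Set} (P? : ∀ i → Dec (P i)) where

  ∈-tabulate⁺ : ∀ {i} → P i → i ∈ tabulate (does ∘ P?)
  ∈-tabulate⁺ {i} p = lookup⇒[]= i _ (trans (lookup∘tabulate _ i) (dec-true (P? i) p))

  ∈-tabulate⁻ : ∀ {i} → i ∈ tabulate (does ∘ P?) → P i
  ∈-tabulate⁻ {i} i∈ with P? i | trans (sym (lookup∘tabulate _ i)) ([]=⇒lookup i∈)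
  ... | yes p | _ = p

module FreshDominator {A : Set} (_≟ᴬ_ : DecidableEquality A) {D : A → Set} {_⊐_ : A → A → Set}
  (⊐-asym : ∀ {x y} → x ⊐ y → ¬ y ⊐ x)
  (⊐-no-3-cycle : ∀ {x y z} → y ⊐ x → z ⊐ y → ¬ x ⊐ z)
  (dominator : ∀ x → Σ A λ y → D y × y ⊐ x) where

  Fresh : A → A → A → Set
  Fresh x y z = Σ A λ w → D w × w ≢ x × w ≢ y × w ≢ z

  fresh-swap : ∀ {x y z} → Fresh x y z → Fresh x z y
  fresh-swap (w , Dw , w≢x , w≢y , w≢z) = w , Dw , w≢x , w≢z , w≢y

  ⊐-irrefl : ∀ {x} → ¬ x ⊐ x
  ⊐-irrefl x⊐x = ⊐-asym x⊐x x⊐x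

  fresh-above-chain : ∀ {x y z} → z ⊐ y → y ⊐ x → Fresh x y z
  fresh-above-chain z⊐y y⊐x with dominator _
  ... | w , Dw , w⊐z = w , Dw , (λ { refl → ⊐-no-3-cycle y⊐x z⊐y w⊐z })
                              , (λ { refl → ⊐-asym z⊐y w⊐z }) , (λ { refl → ⊐-irrefl w⊐z })

  fresh-above : ∀ {x y} → y ⊐ x → ∀ z → Fresh x y z
  fresh-above y⊐x z with dominator _
  ... | w , Dw , w⊐y with w ≟ᴬ z
  ...   | yes refl = fresh-above-chain w⊐y y⊐x
  ...   | no w≢z   = w , Dw , (λ { refl → ⊐-asym y⊐x w⊐y }) , (λ { refl → ⊐-irrefl w⊐y }) , w≢z

  fresh : ∀ x y z → Fresh x y z
  fresh x y z with dominator x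
  ... | w , Dw , w⊐x with w ≟ᴬ y | w ≟ᴬ z
  ...   | yes refl | _        = fresh-above w⊐x z
  ...   | no _     | yes refl = fresh-swap (fresh-above w⊐x y)
  ...   | no w≢y   | no w≢z   = w , Dw , (λ { refl → ⊐-irrefl w⊐x }) , w≢y , w≢z

module _ {n : ℕ} (G : ChickenGraph n) where
  open ChickenGraph G

  private
    Reach : ℕ → Fin n → Fin n → Set
    Reach = Reach≤ G

    Peck : Fin n → Fin n → Set
    Peck = Pecks G

  chain-snoc : ∀ {m c d e} → PeckChain G m c d → Peck d e → PeckChain G (suc m) c e
  chain-snoc here           p = step p here
  chain-snoc (step q chain) p = step q (chain-snoc chain p)

  reach-refl : ∀ {m c} → Reach m c c
  reach-refl = 0 , z≤n , here

  reach-step : ∀ {m c d e} → Peck c d → Reach m d e → Reach (suc m) c e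
  reach-step p (l , l≤m , chain) = suc l , s≤s l≤m , step p chain

  reach-snoc : ∀ {m c d e} → Reach m c d → Peck d e → Reach (suc m) c e
  reach-snoc (l , l≤m , chain) p = suc l , s≤s l≤m , chain-snoc chain p

  reach-weaken : ∀ {m m′ c d} → m ≤ m′ → Reach m c d → Reach m′ c d
  reach-weaken m≤m′ (l , l≤m , chain) = l , ≤-trans l≤m m≤m′ , chain

  reach-zero-inv : ∀ {c e} → Reach 0 c e → c ≡ e
  reach-zero-inv (zero , _ , here) = refl

  reach-suc-inv : ∀ {m c e} → Reach (suc m) c e → c ≡ e ⊎ Σ (Fin n) λ d → Peck c d × Reach m d e
  reach-suc-inv (zero  , _       , here)         = inj₁ refl
  reach-suc-inv (suc l , s≤s l≤m , step p chain) = inj₂ (_ , p , l , l≤m , chain)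

  reach? : ∀ m c e → Dec (Reach m c e)
  reach? zero    c e = map′ (λ { refl → reach-refl }) reach-zero-inv (c ≟ e)
  reach? (suc m) c e =
    map′ [ (λ { refl → reach-refl }) , (λ { (d , p , r) → reach-step p r }) ]′ reach-suc-inv
         ((c ≟ e) ⊎-dec any? λ d → (pecks c d Bool.≟ true) ×-dec reach? m d e)

  private
    reach-if-foreign? : ∀ m d c → Dec (flock c ≢ flock d → Reach m d c)
    reach-if-foreign? m d c = ¬? (flock c ≟ flock d) →-dec reach? m d c

  isDuke? : ∀ m d → Dec (IsDuke G m d)
  isDuke? m d = all? (reach-if-foreign? m d)

  far-from-non-Duke : ∀ {m d} → ¬ IsDuke G m d → Σ (Fin n) λ c → flock c ≢ flock d × ¬ Reach m d c
  far-from-non-Duke {m} {d} ¬duke with ¬∀⟶∃¬ n _ (reach-if-foreign? m d) ¬duke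
  ... | c , ¬duke-at-c = c , (λ same → ¬duke-at-c λ diff → ⊥-elim (diff same))
                           , (λ r → ¬duke-at-c λ _ → r)

  peck⇒flock≢ : ∀ {c d} → Peck c d → flock c ≢ flock d
  peck⇒flock≢ {c} {d} p same with () ← trans (sym p) (same-flock-no-peck c d same)

  peck-asym : ∀ {c d} → Peck c d → ¬ Peck d c
  peck-asym {c} {d} p q with () ← trans (sym q) (antisym c d p)

  peck-back : ∀ {m c d e} → ¬ Reach (suc m) c e → Reach m c d → flock e ≢ flock d → Peck e d
  peck-back {d = d} {e} ¬r r diff with diff-flock-peck e d diff
  ... | inj₁ e→d = e→d
  ... | inj₂ d→e = ⊥-elim (¬r (reach-snoc r d→e))

  peck-back-directly : ∀ {m c e} → ¬ Reach (suc m) c e → flock e ≢ flock c → Peck e c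
  peck-back-directly ¬r = peck-back ¬r reach-refl

  flockmate-pecks : ∀ {m d e a} → ¬ Reach (suc (suc m)) d e → flock e ≡ flock d → Peck d a → Peck e a
  flockmate-pecks ¬r same d→a =
    peck-back ¬r (reach-step d→a reach-refl) (λ ea → peck⇒flock≢ d→a (trans (sym same) ea))

  Outranks : Fin n → Fin n → Set
  Outranks e d = ¬ Reach 2 d e × Σ (Fin n) λ x → Peck e x × ¬ Peck d x

  outranks-asym : ∀ {d e} → Outranks e d → ¬ Outranks d e
  outranks-asym {d} {e} (¬d→e , x , e→x , ¬d→x) (¬e→d , _) with flock e ≟ flock d
  ... | yes same = ¬d→x (flockmate-pecks ¬e→d (sym same) e→x)
  ... | no diff  = peck-asym (peck-back-directly ¬d→e diff) (peck-back-directly ¬e→d (diff ∘ sym))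

  outranks-no-3-cycle : ∀ {a b c} → Outranks b a → Outranks c b → ¬ Outranks a c
  outranks-no-3-cycle {a} {b} {c} (¬ab , x , b→x , ¬a→x) (¬bc , _) (¬ca , _)
    with flock a ≟ flock c | flock c ≟ flock b | flock b ≟ flock a
  ... | no ac  | no cb  | _      = ¬ab (reach-step (peck-back-directly ¬ca ac)
                                        (reach-step (peck-back-directly ¬bc cb) reach-refl))
  ... | no ac  | yes cb | _      = peck-asym (peck-back-directly ¬ca ac)
                                     (flockmate-pecks ¬bc cb (peck-back-directly ¬ab (ac ∘ sym ∘ trans cb)))
  ... | yes ac | _      | no ba  = peck-asym (peck-back-directly ¬ab ba)
                                     (flockmate-pecks ¬ca ac (peck-back-directly ¬bc (ba ∘ sym ∘ trans ac)))
  ... | yes ac | _      | yes ba = ¬a→x (flockmate-pecks ¬ca ac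
                                        (flockmate-pecks ¬bc (trans (sym ac) (sym ba)) b→x))

  reachable₂ : Fin n → Subset n
  reachable₂ t = tabulate (does ∘ reach? 2 t)

  module _ {t z} (zt : flock z ≢ flock t) (¬t→z : ¬ Reach 3 t z) where

    peck-reachable₂ : ∀ {w} → Reach 2 t w → flock w ≢ flock z → Peck z w
    peck-reachable₂ r diff = peck-back ¬t→z r (diff ∘ sym)

    reachable₂-grows : ∀ {v} → Reach 2 t v → Reach 2 z v
    reachable₂-grows {v} r with flock v ≟ flock z
    ... | no diff = reach-step (peck-reachable₂ r diff) reach-refl
    ... | yes same with reach-suc-inv r
    ...   | inj₁ refl = ⊥-elim (zt (sym same))
    ...   | inj₂ (u , t→u , r′) with reach-suc-inv r′
    ...     | inj₁ refl = reach-step (peck-reachable₂ reach-refl (zt ∘ sym)) (reach-step t→u reach-refl)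
    ...     | inj₂ (w , u→w , r″) with refl ← reach-zero-inv r″ =
                reach-step (peck-reachable₂ (reach-step t→u reach-refl) (λ uz → peck⇒flock≢ u→w (trans uz (sym same))))
                           (reach-step u→w reach-refl)

    reachable₂-⊃ : reachable₂ z ⊃ reachable₂ t
    reachable₂-⊃ = ∈-tabulate⁺ (reach? 2 z) ∘ reachable₂-grows ∘ ∈-tabulate⁻ (reach? 2 t)
                 , z , ∈-tabulate⁺ (reach? 2 z) reach-refl
                 , ¬t→z ∘ reach-weaken (s≤s (s≤s z≤n)) ∘ ∈-tabulate⁻ (reach? 2 t)

    still-outranks : ∀ {d} → Outranks t d → Outranks z d
    still-outranks {d} (¬d→t , _) =
      ¬d→z , t , peck-reachable₂ reach-refl (zt ∘ sym) , λ d→t → ¬d→t (reach-step d→t reach-refl)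
      where
        ¬d→z : ¬ Reach 2 d z
        ¬d→z r with flock t ≟ flock d
        ... | no diff = ¬t→z (reach-step (peck-back-directly ¬d→t diff) r)
        ... | yes same with reach-suc-inv r
        ...   | inj₁ refl = zt (sym same)
        ...   | inj₂ (a , d→a , a→z) =
                  ¬t→z (reach-weaken (s≤s (s≤s z≤n)) (reach-step (flockmate-pecks ¬d→t same d→a) a→z))

  climb : ∀ {d} t → Acc _⊃_ (reachable₂ t) → Outranks t d → Σ (Fin n) λ e → IsDuke G 3 e × Outranks e d
  climb t (acc smaller) t-outranks with isDuke? 3 t
  ... | yes duke = t , duke , t-outranks
  ... | no ¬duke with far-from-non-Duke ¬duke
  ...   | z , zt , ¬t→z = climb z (smaller (reachable₂-⊃ zt ¬t→z)) (still-outranks zt ¬t→z t-outranks)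

  outranking-3-Duke : ∀ d → ¬ IsDuke G 2 d → Σ (Fin n) λ e → IsDuke G 3 e × Outranks e d
  outranking-3-Duke d ¬duke with far-from-non-Duke ¬duke
  ... | c , cd , ¬d→c =
    climb c (⊃-wellFounded _) (¬d→c , d , peck-back-directly ¬d→c cd , λ d→d → peck⇒flock≢ d→d refl)

theorem4 : (n : ℕ) (G : ChickenGraph n) →
    NoDuke G 2 → AtLeastDukes G 3 3 → AtLeastDukes G 4 3
theorem4 n G no-2-Duke (f , f-inj , f-Dukes) = extend (fresh _ _ _)
  where
    open FreshDominator _≟_ (outranks-asym G) (outranks-no-3-cycle G)
                            (λ d → outranking-3-Duke G d (no-2-Duke d))

    extend : Fresh (f zero) (f (suc zero)) (f (suc (suc zero))) → AtLeastDukes G 4 3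
    extend (e , e-Duke , e≢f₀ , e≢f₁ , e≢f₂) =
      e ∷ f , ∷-injective f-inj e∉f , λ { zero → e-Duke ; (suc i) → f-Dukes i }
      where
        e∉f : ∀ i → f i ≢ e
        e∉f zero             = e≢f₀ ∘ sym
        e∉f (suc zero)       = e≢f₁ ∘ sym
        e∉f (suc (suc zero)) = e≢f₂ ∘ sym
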